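{- Let $G_1$ and $G_2$ be graphs with exactly one common vertex $x$, let $G=G_1\cup G_2$ be connected, and suppose $x\in V^{01}(G)$. Then: (i) If $f$ is a $\gamma_R$-function on $G$ with $f(x)=1$, then for $i=1,2$ the restriction $f|_{G_i}$ is a $\gamma_R$-function on $G_i$ and $f|_{G_i-x}$ is a $\gamma_R$-function on $G_i-x$. (ii) $\gamma_R(G)=\gamma_R(G_1)+\gamma_R(G_2)-1$. (iii) If $h$ is a $\gamma_R$-function on $G$ with $h(x)=0$, then exactly one of the following holds: (iii.1) $h|_{G_1}$ is a $\gamma_R$-function on $G_1$, $h|_{G_2-x}$ is a $\gamma_R$-function on $G_2-x$, and $h|_{G_2}$ is not an RDF on $G_2$; (iii.2) $h|_{G_1-x}$ is a $\gamma_R$-function on $G_1-x$, $h|_{G_1}$ is not an RDF on $G_1$, and $h|_{G_2}$ is a $\gamma_R$-function on $G_2$. (iv) Either $\{x\}=V^{01}(G_1)\cap V^{01}(G_2)$, or $\{x\}=V^{01}(G_i)\cap V^{1}(G_j)$ for some $\{i,j\}=\{1,2\}$.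
   Context: All graphs are finite and simple. A Roman dominating function (RDF) on a graph $G$ is a map $f:V(G)\to\{0,1,2\}$ such that every vertex $v$ with $f(v)=0$ has a neighbor $u$ with $f(u)=2$; its weight is $\sum_v f(v)$. $\gamma_R(G)$ is the minimum weight of an RDF on $G$; an RDF of that weight is a $\gamma_R$-function. For $X\subseteq\{0,1,2\}$, $V^X(G)$ is the set of vertices $v$ with $\{f(v): f\text{ a }\gamma_R\text{ -function on }G\}=X$; $V^{01}=V^{\{0,1\}}$, $V^{1}=V^{\{1\}}$. $f|_H$ denotes the restriction of $f$ to the subgraph $H$. -}

module Defs where

open import Data.Nat using (ℕ; zero; suc; _+_; _≤_)
open import Data.Bool using (Bool; true; false; if_then_else_)
open import Data.Fin using (Fin)
open import Data.Fin.Subset using (Subset; _∈_; _-_; ⊤)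
open import Data.Vec using (lookup; tabulate)
open import Data.Vec.Functional as VF using ()
open import Data.Product using (Σ; _×_; ∃; ∃-syntax)
open import Relation.Nullary using (¬_)
open import Relation.Binary.PropositionalEquality using (_≡_)

record Graph (n : ℕ) : Set where
  field
    adj    : Fin n → Fin n → Bool
    sym    : ∀ u v → adj u v ≡ adj v u
    irrefl : ∀ v → adj v v ≡ false

open Graph public

Edge : ∀ {n} → Graph n → Fin n → Fin n → Set
Edge G u v = adj G u v ≡ true

data Reach {n} (G : Graph n) : Fin n → Fin n → Set where
  here : ∀ {v} → Reach G v v
  step : ∀ {u w v} → Edge G u w → Reach G w v → Reach G u v

Connected : ∀ {n} → Graph n → Set
Connected G = ∀ u v → Reach G u v

-- Throughout, a subset S of the vertices denotes the induced subgraph G[S];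
-- a function f : Fin n → ℕ on G is considered via its restriction f|_{G[S]}.

weight : ∀ {n} → Subset n → (Fin n → ℕ) → ℕ
weight S f = VF.foldr _+_ 0 (λ v → if lookup S v then f v else 0)

IsRDF : ∀ {n} → Graph n → Subset n → (Fin n → ℕ) → Set
IsRDF G S f =
  (∀ v → v ∈ S → f v ≤ 2) ×
  (∀ v → v ∈ S → f v ≡ 0 → ∃[ u ] (u ∈ S × Edge G v u × f u ≡ 2))

IsγRFun : ∀ {n} → Graph n → Subset n → (Fin n → ℕ) → Set
IsγRFun G S f = IsRDF G S f × (∀ g → IsRDF G S g → weight S f ≤ weight S g)

γR≡ : ∀ {n} → Graph n → Subset n → ℕ → Set
γR≡ {n} G S k = Σ (Fin n → ℕ) λ f → IsγRFun G S f × weight S f ≡ k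

Attains : ∀ {n} → Graph n → Subset n → Fin n → ℕ → Set
Attains G S v k = ∃[ f ] (IsγRFun G S f × f v ≡ k)

InV01 : ∀ {n} → Graph n → Subset n → Fin n → Set
InV01 G S v = v ∈ S × Attains G S v 0 × Attains G S v 1 × ¬ Attains G S v 2

InV1 : ∀ {n} → Graph n → Subset n → Fin n → Set
InV1 G S v = v ∈ S × ¬ Attains G S v 0 × Attains G S v 1 × ¬ Attains G S v 2

-- A γ_R-function f with f(x) = 1 splits along each of the two partitions V₁ ⊔ (V₂ − x) and
-- (V₁ − x) ⊔ V₂ of the vertices into RDFs of the parts. Gluing a cheaper RDF of one part to f
-- on the other part would give a cheaper RDF of G, so every such piece of f is a γ_R-function;
-- this is (i), and (ii) follows because x is counted on both sides. If instead h(x) = 0, then x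
-- has a neighbour u with h(u) = 2, say in V₁; the same gluing argument makes h a γ_R-function on
-- V₁ and on V₂ − x, and h is not an RDF of G[V₂], as its weight there would be
-- γ_R(G[V₂] − x) = γ_R(G[V₂]) − 1. For (iv): x takes the value 1 on both sides (via f), the
-- value 0 on at least one side (via h), and never the value 2, since gluing would carry a value
-- of x on one side back to a γ_R-function of G.
module Submission where

open import Defs hiding (sym)
import Algebra.Properties.CommutativeMonoid.Sum
open import Data.Bool using (true; false; if_then_else_)
import Data.Bool as Bool
open import Data.Empty using (⊥-elim)
open import Data.Fin using (Fin; zero; suc; toℕ; fromℕ<; _≟_; finToFun; funToFin)
open import Data.Fin.Properties using (all?; any?; toℕ-fromℕ<; finToFun-funToFin; punchInᵢ≢i)
open import Data.Fin.Subset using (Subset; _∈_; _∉_; _⊆_; _-_; ⊤; ⁅_⁆)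
open import Data.Fin.Subset.Properties using (_∈?_; ∈⊤; x∈⁅x⁆; x∈⁅y⁆⇒x≡y; x≢y⇒x∉⁅y⁆; p─q⊆p; x∈p∧x≢y⇒x∈p-y)
open import Data.Nat using (ℕ; suc; _+_; _≤_; _≤?_; _^_; s≤s)
import Data.Nat as ℕ
open import Data.Nat.Properties using (+-0-commutativeMonoid; +-identityʳ; +-assoc; +-cancelˡ-≤; +-cancelʳ-≤; +-monoˡ-≤; ≤-trans; ≤-reflexive; ≤-antisym; m⊓n≤n; m≤n⇒m⊓n≡m; module ≤-Reasoning)
open import Data.Product using (_×_; _,_; proj₁; proj₂; ∃; ∃-syntax)
import Data.Product as Product
open import Data.Sum using (_⊎_; inj₁; inj₂; [_,_])
import Data.Sum as Sum
open import Data.Vec using (_∷_; there; lookup)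
open import Data.Vec.Functional using (removeAt)
open import Data.Vec.Properties using ([]=⇒lookup; lookup⇒[]=)
open import Function.Base using (_∘_; const)
open import Function.Bundles using (_⇔_; mk⇔)
open import Relation.Nullary using (¬_; Dec; yes; no; does; contradiction)
open import Relation.Nullary.Decidable using (map′; toSum; _×-dec_; _→-dec_)
open import Relation.Binary.PropositionalEquality using (_≡_; _≢_; refl; sym; trans; cong; cong₂; subst; subst₂; module ≡-Reasoning)

module ∑ = Algebra.Properties.CommutativeMonoid.Sum +-0-commutativeMonoid

x∉p-x : ∀ {n} (p : Subset n) (x : Fin n) → x ∉ p - x
x∉p-x (_ ∷ p) zero    ()
x∉p-x (_ ∷ p) (suc x) (there x∈) = x∉p-x p x x∈

-- weight S f is ∑.sum (zeroOutside S f) by definition.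
zeroOutside : ∀ {n} → Subset n → (Fin n → ℕ) → Fin n → ℕ
zeroOutside S f v = if lookup S v then f v else 0

zeroOutside-∈ : ∀ {n} {S : Subset n} {v} f → v ∈ S → zeroOutside S f v ≡ f v
zeroOutside-∈ f v∈ rewrite []=⇒lookup v∈ = refl

zeroOutside-∉ : ∀ {n} {S : Subset n} {v} f → v ∉ S → zeroOutside S f v ≡ 0
zeroOutside-∉ {S = S} {v} f v∉ with lookup S v in eq
... | true  = contradiction (lookup⇒[]= v S eq) v∉
... | false = refl

weight-⁅⁆ : ∀ {n} (x : Fin n) f → weight ⁅ x ⁆ f ≡ f x
weight-⁅⁆ {suc n} x f = begin
  weight ⁅ x ⁆ f                                                   ≡⟨ ∑.sum-remove {i = x} (zeroOutside ⁅ x ⁆ f) ⟩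
  zeroOutside ⁅ x ⁆ f x + ∑.sum (removeAt (zeroOutside ⁅ x ⁆ f) x) ≡⟨ cong₂ _+_ (zeroOutside-∈ f (x∈⁅x⁆ x)) vanishes ⟩
  f x + 0                                                          ≡⟨ +-identityʳ (f x) ⟩
  f x                                                              ∎
  where
  open ≡-Reasoning
  vanishes : ∑.sum (removeAt (zeroOutside ⁅ x ⁆ f) x) ≡ 0
  vanishes = trans (∑.sum-cong-≗ (λ j → zeroOutside-∉ f (x≢y⇒x∉⁅y⁆ (punchInᵢ≢i x j))))
                   (∑.sum-replicate-zero n)

clamp : ℕ → Fin 3
clamp m = fromℕ< (s≤s (m⊓n≤n m 2))

toℕ-clamp : ∀ {m} → m ≤ 2 → toℕ (clamp m) ≡ m
toℕ-clamp m≤2 = trans (toℕ-fromℕ< _) (m≤n⇒m⊓n≡m m≤2)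

singleton-⇔ : ∀ {n} {P : Fin n → Set} {x} → P x → (∀ v → P v → v ≡ x) → ∀ v → (v ≡ x) ⇔ P v
singleton-⇔ px unique v = mk⇔ (λ { refl → px }) (unique v)

module Weighting {n : ℕ} where

  private
    variable
      A B C S : Subset n
      f g : Fin n → ℕ
      v x : Fin n

  ∈-remove⁻ : v ∈ S - x → v ∈ S × v ≢ x
  ∈-remove⁻ {S = S} {x = x} v∈ = p─q⊆p S ⁅ x ⁆ v∈ , λ { refl → x∉p-x S x v∈ }

  record Split (C A B : Subset n) : Set where
    field
      cover    : v ∈ C → v ∈ A ⊎ v ∈ B
      ⊆ˡ       : A ⊆ C
      ⊆ʳ       : B ⊆ C
      disjoint : v ∈ A → v ∉ B

  Split-swap : Split C A B → Split C B A
  Split-swap P = record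
    { cover = Sum.swap ∘ cover ; ⊆ˡ = ⊆ʳ ; ⊆ʳ = ⊆ˡ ; disjoint = λ v∈B v∈A → disjoint v∈A v∈B }
    where open Split P

  Split-remove : x ∈ S → Split S (S - x) ⁅ x ⁆
  Split-remove {x = x} {S = S} x∈S = record
    { cover    = cover
    ; ⊆ˡ       = proj₁ ∘ ∈-remove⁻
    ; ⊆ʳ       = λ v∈⁅x⁆ → subst (_∈ S) (sym (x∈⁅y⁆⇒x≡y x v∈⁅x⁆)) x∈S
    ; disjoint = λ v∈S-x v∈⁅x⁆ → proj₂ (∈-remove⁻ v∈S-x) (x∈⁅y⁆⇒x≡y x v∈⁅x⁆)
    }
    where
    cover : v ∈ S → v ∈ S - x ⊎ v ∈ ⁅ x ⁆
    cover {v} v∈S with v ≟ x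
    ... | yes refl = inj₂ (x∈⁅x⁆ x)
    ... | no  v≢x  = inj₁ (x∈p∧x≢y⇒x∈p-y v∈S v≢x)

  EqualOn : Subset n → (Fin n → ℕ) → (Fin n → ℕ) → Set
  EqualOn S f g = ∀ v → v ∈ S → f v ≡ g v

  weight-cong : ∀ S → EqualOn S f g → weight S f ≡ weight S g
  weight-cong {f = f} {g} S f≗g = ∑.sum-cong-≗ pointwise
    where
    pointwise : ∀ v → zeroOutside S f v ≡ zeroOutside S g v
    pointwise v with v ∈? S
    ... | yes v∈ rewrite zeroOutside-∈ f v∈ | zeroOutside-∈ g v∈ = f≗g v v∈
    ... | no  v∉ rewrite zeroOutside-∉ f v∉ | zeroOutside-∉ g v∉ = refl

  weight-split : ∀ f → Split C A B → weight C f ≡ weight A f + weight B f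
  weight-split {C = C} {A} {B} f P =
    trans (∑.sum-cong-≗ pointwise) (∑.∑-distrib-+ (zeroOutside A f) (zeroOutside B f))
    where
    open Split P
    pointwise : ∀ v → zeroOutside C f v ≡ zeroOutside A f v + zeroOutside B f v
    pointwise v with v ∈? A | v ∈? B
    ... | yes v∈A | _
      rewrite zeroOutside-∈ f (⊆ˡ v∈A) | zeroOutside-∈ f v∈A
            | zeroOutside-∉ f (disjoint v∈A) = sym (+-identityʳ (f v))
    ... | no v∉A | yes v∈B
      rewrite zeroOutside-∈ f (⊆ʳ v∈B) | zeroOutside-∉ f v∉A | zeroOutside-∈ f v∈B = refl
    ... | no v∉A | no v∉B
      rewrite zeroOutside-∉ f v∉A | zeroOutside-∉ f v∉B = zeroOutside-∉ f ([ v∉A , v∉B ] ∘ cover)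

  weight-remove : ∀ f → x ∈ S → weight S f ≡ weight (S - x) f + f x
  weight-remove {x = x} {S = S} f x∈S =
    trans (weight-split f (Split-remove x∈S)) (cong (weight (S - x) f +_) (weight-⁅⁆ x f))

  glue : Subset n → (Fin n → ℕ) → (Fin n → ℕ) → Fin n → ℕ
  glue A a b v = if does (v ∈? A) then a v else b v

  glue-on-A : ∀ a b → EqualOn A (glue A a b) a
  glue-on-A {A = A} a b v v∈A with v ∈? A
  ... | yes _   = refl
  ... | no v∉A = contradiction v∈A v∉A

  glue-on-B : ∀ a b → Split C A B → EqualOn B (glue A a b) b
  glue-on-B {A = A} a b P v v∈B with v ∈? A
  ... | yes v∈A = contradiction v∈B (Split.disjoint P v∈A)
  ... | no _    = refl

  weight-glue : ∀ a b → Split C A B → weight C (glue A a b) ≡ weight A a + weight B b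
  weight-glue {A = A} {B} a b P = trans (weight-split (glue A a b) P)
    (cong₂ _+_ (weight-cong A (glue-on-A a b)) (weight-cong B (glue-on-B a b P)))

open Weighting

module RomanDomination {n : ℕ} (G : Graph n) where

  private
    variable
      A B C S V₁ V₂ : Subset n
      a b f f₀ f₁ f₂ g h : Fin n → ℕ
      u v x : Fin n
      k : ℕ

  IsRDF-cong : EqualOn S f g → IsRDF G S f → IsRDF G S g
  IsRDF-cong f≗g (bounded , dominated) =
    (λ v v∈ → subst (_≤ 2) (f≗g v v∈) (bounded v v∈)) ,
    λ v v∈ gv≡0 → Product.map₂ (λ (u∈ , vu , fu≡2) → u∈ , vu , trans (sym (f≗g _ u∈)) fu≡2)
                               (dominated v v∈ (trans (f≗g v v∈) gv≡0))

  IsRDF-union : Split C A B → IsRDF G A f → IsRDF G B f → IsRDF G C f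
  IsRDF-union P (boundedᴬ , dominatedᴬ) (boundedᴮ , dominatedᴮ) =
    (λ v v∈ → [ boundedᴬ v , boundedᴮ v ] (cover v∈)) ,
    λ v v∈ fv≡0 → [ (λ v∈A → Product.map₂ (Product.map₁ ⊆ˡ) (dominatedᴬ v v∈A fv≡0))
                  , (λ v∈B → Product.map₂ (Product.map₁ ⊆ʳ) (dominatedᴮ v v∈B fv≡0)) ] (cover v∈)
    where open Split P

  IsRDF-glue : Split C A B → IsRDF G A a → IsRDF G B b → IsRDF G C (glue A a b)
  IsRDF-glue {a = a} {b = b} P ra rb =
    IsRDF-union P (IsRDF-cong (λ v v∈ → sym (glue-on-A a b v v∈)) ra)
                  (IsRDF-cong (λ v v∈ → sym (glue-on-B a b P v v∈)) rb)

  IsRDF? : ∀ S f → Dec (IsRDF G S f)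
  IsRDF? S f =
    all? (λ v → v ∈? S →-dec f v ≤? 2) ×-dec
    all? (λ v → v ∈? S →-dec f v ℕ.≟ 0 →-dec
                any? (λ u → u ∈? S ×-dec adj G v u Bool.≟ true ×-dec f u ℕ.≟ 2))

  γR-weight-unique : IsγRFun G S f → IsγRFun G S g → weight S f ≡ weight S g
  γR-weight-unique (rf , minf) (rg , ming) = ≤-antisym (minf _ rg) (ming _ rf)

  γR-if-lighter : IsγRFun G S f → IsRDF G S g → weight S g ≤ weight S f → IsγRFun G S g
  γR-if-lighter (_ , minf) rg g≤f = rg , λ h rh → ≤-trans g≤f (minf h rh)

  γR-restrict : Split C A B → IsγRFun G C f → IsRDF G A f → IsRDF G B f → IsγRFun G A f
  γR-restrict {A = A} {B} {f = f} P (_ , minf) rA rB = rA , λ a ra →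
    +-cancelʳ-≤ (weight B f) (weight A f) (weight A a)
      (subst₂ _≤_ (weight-split f P) (weight-glue a f P) (minf (glue A a f) (IsRDF-glue P ra rB)))

  γR-glue : Split C A B → IsγRFun G C f → IsRDF G A f → IsRDF G B f →
            IsγRFun G A g → IsγRFun G C (glue A g f)
  γR-glue {C = C} {A} {B} {f = f} {g = g} P γf rA rB γg =
    γR-if-lighter γf (IsRDF-glue P (proj₁ γg) rB) (≤-reflexive (begin
      weight C (glue A g f)    ≡⟨ weight-glue g f P ⟩
      weight A g + weight B f  ≡⟨ cong (_+ weight B f) (γR-weight-unique γg (γR-restrict P γf rA rB)) ⟩
      weight A f + weight B f  ≡⟨ weight-split f P ⟨
      weight C f               ∎))
    where open ≡-Reasoning

  -- On G[S] such an h would weigh γ_R(G[S] − x), which f shows is less than γ_R(G[S]).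
  γR-remove-vertex : x ∈ S → IsγRFun G S f → f x ≡ 1 → IsRDF G (S - x) f →
                     IsγRFun G (S - x) h → h x ≡ 0 → ¬ IsRDF G S h
  γR-remove-vertex {x = x} {S = S} {f = f} {h = h} x∈S (_ , minf) fx≡1 rf (_ , minh) hx≡0 rh =
    contradiction (+-cancelˡ-≤ (weight (S - x) f) 1 0 (begin
      weight (S - x) f + 1    ≡⟨ cong (weight (S - x) f +_) fx≡1 ⟨
      weight (S - x) f + f x  ≡⟨ weight-remove f x∈S ⟨
      weight S f              ≤⟨ minf h rh ⟩
      weight S h              ≡⟨ weight-remove h x∈S ⟩
      weight (S - x) h + h x  ≡⟨ cong (weight (S - x) h +_) hx≡0 ⟩
      weight (S - x) h + 0    ≤⟨ +-monoˡ-≤ 0 (minh f rf) ⟩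
      weight (S - x) f + 0    ∎)) λ ()
    where open ≤-Reasoning

  -- A γ_R-function on S is bounded by 2 there, so on S it agrees with one of the 3ⁿ functions
  -- Fin n → Fin 3; such a candidate is a γ_R-function iff it is an RDF no heavier than f.
  Attains? : IsγRFun G S f → v ∈ S → ∀ k → Dec (Attains G S v k)
  Attains? {S = S} {f = f} {v = v} γf v∈S k = map′ sound complete (any? Candidate?)
    where
    decode : Fin (3 ^ n) → Fin n → ℕ
    decode i = toℕ ∘ finToFun i

    Candidate : Fin (3 ^ n) → Set
    Candidate i = IsRDF G S (decode i) × decode i v ≡ k × weight S (decode i) ≤ weight S f

    Candidate? : ∀ i → Dec (Candidate i)
    Candidate? i = IsRDF? S (decode i) ×-dec decode i v ℕ.≟ k ×-dec weight S (decode i) ≤? weight S f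

    sound : ∃ Candidate → Attains G S v k
    sound (i , ri , iv≡k , i≤f) = decode i , γR-if-lighter γf ri i≤f , iv≡k

    complete : Attains G S v k → ∃ Candidate
    complete (g , (rg , ming) , gv≡k) =
      i , IsRDF-cong encoded rg , trans (sym (encoded v v∈S)) gv≡k ,
      subst (_≤ weight S f) (weight-cong S encoded) (ming f (proj₁ γf))
      where
      i = funToFin (clamp ∘ g)
      encoded : EqualOn S g (decode i)
      encoded u u∈S = sym (trans (cong toℕ (finToFun-funToFin (clamp ∘ g) u)) (toℕ-clamp (proj₁ rg u u∈S)))

  record Amalgam (V₁ V₂ : Subset n) (x : Fin n) : Set where
    field
      x∈V₁        : x ∈ V₁
      x∈V₂        : x ∈ V₂
      V₁∩V₂⊆x     : ∀ v → v ∈ V₁ → v ∈ V₂ → v ≡ x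
      V₁∪V₂       : ∀ v → v ∈ V₁ ⊎ v ∈ V₂
      edge-within : ∀ u v → Edge G u v → (u ∈ V₁ × v ∈ V₁) ⊎ (u ∈ V₂ × v ∈ V₂)

  Amalgam-swap : Amalgam V₁ V₂ x → Amalgam V₂ V₁ x
  Amalgam-swap am = record
    { x∈V₁        = x∈V₂
    ; x∈V₂        = x∈V₁
    ; V₁∩V₂⊆x     = λ v v∈V₂ v∈V₁ → V₁∩V₂⊆x v v∈V₁ v∈V₂
    ; V₁∪V₂       = Sum.swap ∘ V₁∪V₂
    ; edge-within = λ u v uv → Sum.swap (edge-within u v uv)
    }
    where open Amalgam am

  Amalgam-split : Amalgam V₁ V₂ x → Split ⊤ V₁ (V₂ - x)
  Amalgam-split {V₁ = V₁} {V₂} {x} am =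
    record { cover = cover ; ⊆ˡ = const ∈⊤ ; ⊆ʳ = const ∈⊤ ; disjoint = disjoint }
    where
    open Amalgam am
    cover : v ∈ ⊤ → v ∈ V₁ ⊎ v ∈ V₂ - x
    cover {v} _ with V₁∪V₂ v | v ≟ x
    ... | inj₁ v∈V₁ | _        = inj₁ v∈V₁
    ... | inj₂ _    | yes refl = inj₁ x∈V₁
    ... | inj₂ v∈V₂ | no v≢x   = inj₂ (x∈p∧x≢y⇒x∈p-y v∈V₂ v≢x)
    disjoint : v ∈ V₁ → v ∉ V₂ - x
    disjoint v∈V₁ v∈V₂-x = let (v∈V₂ , v≢x) = ∈-remove⁻ v∈V₂-x in v≢x (V₁∩V₂⊆x _ v∈V₁ v∈V₂)

  Amalgam-neighbour : Amalgam V₁ V₂ x → v ∈ V₁ → v ≢ x → Edge G v u → u ∈ V₁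
  Amalgam-neighbour am v∈V₁ v≢x vu with Amalgam.edge-within am _ _ vu
  ... | inj₁ (_ , u∈V₁) = u∈V₁
  ... | inj₂ (v∈V₂ , _) = contradiction (Amalgam.V₁∩V₂⊆x am _ v∈V₁ v∈V₂) v≢x

  IsRDF-restrict : Amalgam V₁ V₂ x → IsRDF G ⊤ f →
                   (f x ≡ 0 → ∃[ u ] (u ∈ V₁ × Edge G x u × f u ≡ 2)) → IsRDF G V₁ f
  IsRDF-restrict {V₁ = V₁} {x = x} {f = f} am (bounded , dominated) x-dominated =
    (λ v _ → bounded v ∈⊤) , dominatedᵥ
    where
    dominatedᵥ : ∀ v → v ∈ V₁ → f v ≡ 0 → ∃[ u ] (u ∈ V₁ × Edge G v u × f u ≡ 2)
    dominatedᵥ v v∈V₁ fv≡0 with v ≟ x | dominated v ∈⊤ fv≡0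
    ... | yes refl | _                  = x-dominated fv≡0
    ... | no v≢x   | u , _ , vu , fu≡2 = u , Amalgam-neighbour am v∈V₁ v≢x vu , vu , fu≡2

  IsRDF-restrict-x : Amalgam V₁ V₂ x → IsRDF G ⊤ f → f x ≢ 2 → IsRDF G (V₁ - x) f
  IsRDF-restrict-x {V₁ = V₁} {x = x} {f = f} am (bounded , dominated) fx≢2 =
    (λ v _ → bounded v ∈⊤) , dominatedᵥ
    where
    dominatedᵥ : ∀ v → v ∈ V₁ - x → f v ≡ 0 → ∃[ u ] (u ∈ V₁ - x × Edge G v u × f u ≡ 2)
    dominatedᵥ v v∈V₁-x fv≡0 with ∈-remove⁻ v∈V₁-x | dominated v ∈⊤ fv≡0
    ... | v∈V₁ , v≢x | u , _ , vu , fu≡2 =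
      u , x∈p∧x≢y⇒x∈p-y (Amalgam-neighbour am v∈V₁ v≢x vu) (λ { refl → fx≢2 fu≡2 }) , vu , fu≡2

  IsRDF-restrict-at-1 : Amalgam V₁ V₂ x → IsRDF G ⊤ f → f x ≡ 1 → IsRDF G V₁ f × IsRDF G (V₁ - x) f
  IsRDF-restrict-at-1 am rf fx≡1 =
    IsRDF-restrict am rf (λ fx≡0 → contradiction (trans (sym fx≡1) fx≡0) λ ()) ,
    IsRDF-restrict-x am rf (λ fx≡2 → contradiction (trans (sym fx≡1) fx≡2) λ ())

  γR-restrict-at-1 : Amalgam V₁ V₂ x → IsγRFun G ⊤ f → f x ≡ 1 → IsγRFun G V₁ f × IsγRFun G (V₁ - x) f
  γR-restrict-at-1 am γf fx≡1 =
    γR-restrict (Amalgam-split am) γf (proj₁ rfV₁) (proj₂ rfV₂) ,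
    γR-restrict (Split-swap (Amalgam-split (Amalgam-swap am))) γf (proj₂ rfV₁) (proj₁ rfV₂)
    where
    rfV₁ = IsRDF-restrict-at-1 am (proj₁ γf) fx≡1
    rfV₂ = IsRDF-restrict-at-1 (Amalgam-swap am) (proj₁ γf) fx≡1

  γR-weight-sum : Amalgam V₁ V₂ x → IsγRFun G ⊤ f → f x ≡ 1 →
                  IsγRFun G ⊤ f₀ → IsγRFun G V₁ f₁ → IsγRFun G V₂ f₂ →
                  weight ⊤ f₀ + 1 ≡ weight V₁ f₁ + weight V₂ f₂
  γR-weight-sum {V₁ = V₁} {V₂} {x} {f} {f₀} {f₁} {f₂} am γf fx≡1 γf₀ γf₁ γf₂ = begin
    weight ⊤ f₀ + 1                        ≡⟨ cong (_+ 1) (γR-weight-unique γf₀ γf) ⟩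
    weight ⊤ f + 1                         ≡⟨ cong (_+ 1) (weight-split f (Amalgam-split am)) ⟩
    weight V₁ f + weight (V₂ - x) f + 1    ≡⟨ +-assoc (weight V₁ f) _ 1 ⟩
    weight V₁ f + (weight (V₂ - x) f + 1)  ≡⟨ cong (λ fx → weight V₁ f + (weight (V₂ - x) f + fx)) fx≡1 ⟨
    weight V₁ f + (weight (V₂ - x) f + f x) ≡⟨ cong (weight V₁ f +_) (weight-remove f (Amalgam.x∈V₂ am)) ⟨
    weight V₁ f + weight V₂ f              ≡⟨ cong₂ _+_ (γR-weight-unique (proj₁ (γR-restrict-at-1 am γf fx≡1)) γf₁)
                                                       (γR-weight-unique (proj₁ (γR-restrict-at-1 (Amalgam-swap am) γf fx≡1)) γf₂) ⟩
    weight V₁ f₁ + weight V₂ f₂            ∎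
    where open ≡-Reasoning

  Attains-lift : Amalgam V₁ V₂ x → IsγRFun G ⊤ f → f x ≡ 1 → Attains G V₁ x k → Attains G ⊤ x k
  Attains-lift {V₁ = V₁} {x = x} {f = f} am γf fx≡1 (g , γg , gx≡k) =
    glue V₁ g f ,
    γR-glue (Amalgam-split am) γf (proj₁ (IsRDF-restrict-at-1 am (proj₁ γf) fx≡1))
            (proj₂ (IsRDF-restrict-at-1 (Amalgam-swap am) (proj₁ γf) fx≡1)) γg ,
    trans (glue-on-A g f x (Amalgam.x∈V₁ am)) gx≡k

  InV01⊎InV1 : Amalgam V₁ V₂ x → IsγRFun G ⊤ f → f x ≡ 1 → ¬ Attains G ⊤ x 2 →
               InV01 G V₁ x ⊎ InV1 G V₁ x
  InV01⊎InV1 {f = f} am γf fx≡1 ¬attains-2 =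
    Sum.map (λ attains-0 → x∈V₁ , attains-0 , attains-1 , ¬attains-2 ∘ Attains-lift am γf fx≡1)
            (λ ¬attains-0 → x∈V₁ , ¬attains-0 , attains-1 , ¬attains-2 ∘ Attains-lift am γf fx≡1)
            (toSum (Attains? γfV₁ x∈V₁ 0))
    where
    open Amalgam am
    γfV₁ = proj₁ (γR-restrict-at-1 am γf fx≡1)
    attains-1 = f , γfV₁ , fx≡1

  γR-restrict-at-0 : Amalgam V₁ V₂ x → IsγRFun G ⊤ f → f x ≡ 1 → IsγRFun G ⊤ h → h x ≡ 0 →
                     u ∈ V₁ → Edge G x u → h u ≡ 2 →
                     IsγRFun G V₁ h × IsγRFun G (V₂ - x) h × ¬ IsRDF G V₂ h
  γR-restrict-at-0 {V₂ = V₂} {x = x} {f = f} {h = h} {u = u} am γf fx≡1 γh hx≡0 u∈V₁ xu hu≡2 =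
    γhV₁ , γhV₂-x , γR-remove-vertex (Amalgam.x∈V₂ am) γfV₂ fx≡1 rfV₂-x γhV₂-x hx≡0
    where
    split = Amalgam-split am
    rhV₁ = IsRDF-restrict am (proj₁ γh) (λ _ → u , u∈V₁ , xu , hu≡2)
    rhV₂-x = IsRDF-restrict-x (Amalgam-swap am) (proj₁ γh) (λ hx≡2 → contradiction (trans (sym hx≡0) hx≡2) λ ())
    γhV₁ = γR-restrict split γh rhV₁ rhV₂-x
    γhV₂-x = γR-restrict (Split-swap split) γh rhV₂-x rhV₁
    γfV₂ = proj₁ (γR-restrict-at-1 (Amalgam-swap am) γf fx≡1)
    rfV₂-x = proj₂ (IsRDF-restrict-at-1 (Amalgam-swap am) (proj₁ γf) fx≡1)

  γR-restrict-at-0-exclusive :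
    Amalgam V₁ V₂ x → IsγRFun G ⊤ f → f x ≡ 1 → ∀ h → IsγRFun G ⊤ h → h x ≡ 0 →
    let A = IsγRFun G V₁ h × IsγRFun G (V₂ - x) h × ¬ IsRDF G V₂ h
        B = IsγRFun G (V₁ - x) h × ¬ IsRDF G V₁ h × IsγRFun G V₂ h
    in (A × ¬ B) ⊎ (B × ¬ A)
  γR-restrict-at-0-exclusive {x = x} am γf fx≡1 h γh hx≡0 with proj₂ (proj₁ γh) x ∈⊤ hx≡0
  ... | u , _ , xu , hu≡2 with Amalgam.edge-within am x u xu
  ... | inj₁ (_ , u∈V₁) =
    inj₁ (viaV₁ , λ (_ , ¬rhV₁ , _) → ¬rhV₁ (proj₁ (proj₁ viaV₁)))
    where viaV₁ = γR-restrict-at-0 am γf fx≡1 γh hx≡0 u∈V₁ xu hu≡2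
  ... | inj₂ (_ , u∈V₂) =
    inj₂ ((γhV₁-x , ¬rhV₁ , γhV₂) , λ (_ , _ , ¬rhV₂) → ¬rhV₂ (proj₁ γhV₂))
    where
    viaV₂ = γR-restrict-at-0 (Amalgam-swap am) γf fx≡1 γh hx≡0 u∈V₂ xu hu≡2
    γhV₂ = proj₁ viaV₂
    γhV₁-x = proj₁ (proj₂ viaV₂)
    ¬rhV₁ = proj₂ (proj₂ viaV₂)


  Attains-0-on-a-side : Amalgam V₁ V₂ x → IsγRFun G ⊤ f → f x ≡ 1 → IsγRFun G ⊤ h → h x ≡ 0 →
                        Attains G V₁ x 0 ⊎ Attains G V₂ x 0
  Attains-0-on-a-side {h = h} am γf fx≡1 γh hx≡0 =
    Sum.map (λ (A , _) → h , proj₁ A , hx≡0) (λ (B , _) → h , proj₂ (proj₂ B) , hx≡0)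
            (γR-restrict-at-0-exclusive am γf fx≡1 h γh hx≡0)

  InV01-classification :
    Amalgam V₁ V₂ x → InV01 G ⊤ x →
    (∀ v → (v ≡ x) ⇔ (InV01 G V₁ v × InV01 G V₂ v))
    ⊎ (∀ v → (v ≡ x) ⇔ (InV01 G V₁ v × InV1 G V₂ v))
    ⊎ (∀ v → (v ≡ x) ⇔ (InV01 G V₂ v × InV1 G V₁ v))
  InV01-classification am (_ , (_ , γh , hx≡0) , (_ , γf , fx≡1) , ¬attains-2)
    with InV01⊎InV1 am γf fx≡1 ¬attains-2 | InV01⊎InV1 (Amalgam-swap am) γf fx≡1 ¬attains-2
  ... | inj₁ x∈V01₁ | inj₁ x∈V01₂ =
    inj₁ (singleton-⇔ (x∈V01₁ , x∈V01₂) λ v (p , q) → Amalgam.V₁∩V₂⊆x am v (proj₁ p) (proj₁ q))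
  ... | inj₁ x∈V01₁ | inj₂ x∈V1₂ =
    inj₂ (inj₁ (singleton-⇔ (x∈V01₁ , x∈V1₂) λ v (p , q) → Amalgam.V₁∩V₂⊆x am v (proj₁ p) (proj₁ q)))
  ... | inj₂ x∈V1₁ | inj₁ x∈V01₂ =
    inj₂ (inj₂ (singleton-⇔ (x∈V01₂ , x∈V1₁) λ v (q , p) → Amalgam.V₁∩V₂⊆x am v (proj₁ p) (proj₁ q)))
  ... | inj₂ (_ , ¬attains-0₁ , _) | inj₂ (_ , ¬attains-0₂ , _) =
    ⊥-elim ([ ¬attains-0₁ , ¬attains-0₂ ] (Attains-0-on-a-side am γf fx≡1 γh hx≡0))

proposition3p1 :
  ∀ {n} (G : Graph n) (V₁ V₂ : Subset n) (x : Fin n) →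
  x ∈ V₁ → x ∈ V₂ →
  (∀ v → v ∈ V₁ → v ∈ V₂ → v ≡ x) →
  (∀ v → v ∈ V₁ ⊎ v ∈ V₂) →
  (∀ u v → Edge G u v → (u ∈ V₁ × v ∈ V₁) ⊎ (u ∈ V₂ × v ∈ V₂)) →
  Connected G →
  InV01 G ⊤ x →
  ((∀ f → IsγRFun G ⊤ f → f x ≡ 1 →
      (IsγRFun G V₁ f × IsγRFun G (V₁ - x) f) ×
      (IsγRFun G V₂ f × IsγRFun G (V₂ - x) f))
  × (∀ k k₁ k₂ → γR≡ G ⊤ k → γR≡ G V₁ k₁ → γR≡ G V₂ k₂ → k + 1 ≡ k₁ + k₂)
  × (∀ h → IsγRFun G ⊤ h → h x ≡ 0 →
      let A = IsγRFun G V₁ h × IsγRFun G (V₂ - x) h × ¬ IsRDF G V₂ h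
          B = IsγRFun G (V₁ - x) h × ¬ IsRDF G V₁ h × IsγRFun G V₂ h
      in (A × ¬ B) ⊎ (B × ¬ A))
  × ((∀ v → (v ≡ x) ⇔ (InV01 G V₁ v × InV01 G V₂ v))
     ⊎ (∀ v → (v ≡ x) ⇔ (InV01 G V₁ v × InV1 G V₂ v))
     ⊎ (∀ v → (v ≡ x) ⇔ (InV01 G V₂ v × InV1 G V₁ v))))
proposition3p1 G V₁ V₂ x x∈V₁ x∈V₂ V₁∩V₂⊆x V₁∪V₂ edge-within _ x∈V01@(_ , _ , (_ , γf , fx≡1) , _) =
  (λ _ γf′ f′x≡1 → γR-restrict-at-1 am γf′ f′x≡1 , γR-restrict-at-1 (Amalgam-swap am) γf′ f′x≡1) ,
  (λ { _ _ _ (_ , γf₀ , refl) (_ , γf₁ , refl) (_ , γf₂ , refl) → γR-weight-sum am γf fx≡1 γf₀ γf₁ γf₂ }) ,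
  γR-restrict-at-0-exclusive am γf fx≡1 ,
  InV01-classification am x∈V01
  where
  open RomanDomination G
  am : Amalgam V₁ V₂ x
  am = record { x∈V₁ = x∈V₁ ; x∈V₂ = x∈V₂ ; V₁∩V₂⊆x = V₁∩V₂⊆x ; V₁∪V₂ = V₁∪V₂ ; edge-within = edge-within }
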